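{- Let $n \ge 4$ and let the hiding devil play Gauss's circle strategy on the $n$-dimensional infinite grid against the drunk angel of power $c$. Then for a given $c \in \mathbb{N}$ and a real number $\epsilon>0$, $P[A^{n}_{k,c}] \to 0$ as $k \to \infty$.
   Context: The $n$-dimensional infinite grid has vertex set $\mathbb{Z}^n$. For $x=(x_1,\dots,x_n)$ let $\|x\| = \max_i |x_i|$ and $d(x,y)=\|x-y\|$. The lattice sphere of radius $r$ is $L^n_r = \{x \in \mathbb{Z}^n : \|x\| \le r\}$, and the hollow lattice sphere of inner radius $k$ and thickness $c$ is $H^n_{k,c} = L^n_{k+c} \setminus L^n_{k-1}$. The drunk angel of power $c$ starts at the origin and in each turn moves from her current vertex $x$ to each vertex $y$ with $d(x,y)\le c$ with probability $\frac{1}{(2c+1)^n}$, independently of previous turns. Gauss's circle strategy: the hiding devil secretly destroys one vertex per turn for $N = |H^n_{k,c}|$ turns, building $H^n_{k,c}$; destroyed vertices do not affect the angel's moves. After the angel's $N$-th move the devil reveals $H^n_{k,c}$, and $A^n_{k,c}$ is the event that the angel's position then lies in the inner part of $H^n_{k,c}$ (the region it encloses, i.e. points at distance less than $k$ from the origin). -}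

module Defs where

open import Data.Bool using (Bool; if_then_else_)
open import Data.Nat as ℕ using (ℕ; zero; suc; _⊔_; _∸_; _^_; _<?_)
open import Data.Nat.Properties using (m^n≢0)
open import Data.Integer as ℤ using (ℤ; +_; ∣_∣)
open import Data.List using (List; []; _∷_; map; concatMap; upTo)
open import Data.Nat.ListAction using (sum)
open import Data.Vec using (Vec; []; _∷_; zipWith; replicate)
open import Data.Rational using (ℚ; _/_)
open import Relation.Nullary using (does)

‖_‖ : ∀ {n} → Vec ℤ n → ℕ
‖ [] ‖ = 0
‖ x ∷ xs ‖ = ∣ x ∣ ⊔ ‖ xs ‖

dist : ∀ {n} → Vec ℤ n → Vec ℤ n → ℕ
dist x y = ‖ zipWith ℤ._-_ x y ‖

origin : ∀ n → Vec ℤ n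
origin n = replicate n (+ 0)

range : ℕ → List ℤ
range c = map (λ i → + i ℤ.- + c) (upTo (suc (2 ℕ.* c)))

steps : ∀ n → ℕ → List (Vec ℤ n)
steps zero c = [] ∷ []
steps (suc n) c = concatMap (λ z → map (z ∷_) (steps n c)) (range c)

sizeL : ℕ → ℕ → ℕ
sizeL n r = (suc (2 ℕ.* r)) ^ n

-- |L^n_{k-1}| (L^n_{-1} = ∅)
sizeInner : ℕ → ℕ → ℕ
sizeInner n zero = 0
sizeInner n (suc j) = sizeL n j

-- N = |H^n_{k,c}| = |L^n_{k+c}| - |L^n_{k-1}|
sizeH : ℕ → ℕ → ℕ → ℕ
sizeH n k c = sizeL n (k ℕ.+ c) ∸ sizeInner n k

inner : ∀ {n} → ℕ → Vec ℤ n → Bool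
inner k x = does (‖ x ‖ <? k)

-- number of equally likely angel trajectories of m further moves
-- (each move from x to x+s, s among the (2c+1)^n vectors with ‖s‖ ≤ c)
-- starting at x and ending in the inner region ‖y‖ < k
goodWalks : ∀ n → (c k m : ℕ) → Vec ℤ n → ℕ
goodWalks n c k zero x = if inner k x then 1 else 0
goodWalks n c k (suc m) x =
  sum (map (λ s → goodWalks n c k m (zipWith ℤ._+_ x s)) (steps n c))

totalWalks : ℕ → ℕ → ℕ → ℕ
totalWalks n c m = ((suc (2 ℕ.* c)) ^ n) ^ m

-- P[A^n_{k,c}]: angel starts at origin, makes N = |H^n_{k,c}| moves
probA : ℕ → ℕ → ℕ → ℚ
probA n k c =
  _/_ (+ goodWalks n c k (sizeH n k c) (origin n)) (totalWalks n c (sizeH n k c))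
      {{m^n≢0 ((suc (2 ℕ.* c)) ^ n) (sizeH n k c) {{m^n≢0 (suc (2 ℕ.* c)) n}}}}

-- Projecting onto the first coordinate, the angel's N = |H^n_{k,c}| moves form a walk on ℤ with
-- steps uniform on [-c, c], and P[A^n_{k,c}] is at most the probability that this walk ends in
-- (-k, k); for n ≥ 4, N ≥ 32k³. Pairing the values -c+2i and -c+2i+1 writes each step as a fixed
-- offset plus, with probability 2c/(2c+1), a fair 0/1 coin. Once T coins have been tossed, a window
-- of 2k sites is hit with probability at most 2k C(T,T/2)/2^T ≤ 2k/√(T+1); fewer than T tosses among
-- N ≥ 2T steps has probability at most 2^N (2c)^T/(2c+1)^N. With T = 4(2kq)² both terms are below
-- 1/(2q), so P[A^n_{k,c}] < 1/q as soon as k > q².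

module Submission where

open import Defs

module RandomWalk where

  open import Data.Bool as Bool using (true; false; if_then_else_)
  open import Data.Empty using (⊥-elim)
  open import Data.Integer as ℤ using (ℤ; +_; -[1+_]; ∣_∣)
  import Data.Integer.Properties as ℤ
  import Data.Integer.Tactic.RingSolver as ℤ-Solver
  open import Data.List using (List; []; _∷_; _++_; map; concatMap; applyUpTo; upTo; length)
  open import Data.List.Properties using (map-cong; map-∘; map-++; map-upTo; length-map; length-upTo; length-++)
  open import Data.Nat as ℕ using (ℕ; zero; suc; _+_; _*_; _∸_; _^_; _≤_; _<_; _<?_; _⊔_; z≤n; s≤s; ⌊_/2⌋; NonZero)
  open import Data.Nat.Combinatorics using (_C_; nCk+nC[k+1]≡[n+1]C[k+1]; nC1≡n)
  open import Data.Nat.ListAction using (sum)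
  open import Data.Nat.ListAction.Properties using (sum-++)
  open import Data.Nat.Properties
  open import Data.Nat.Tactic.RingSolver using (solve-∀)
  open import Data.Product using (∃₂; _,_)
  open import Data.Rational as ℚ using (mkℚ; 0ℚ; _/_) renaming (_<_ to _<ℚ_)
  import Data.Rational.Properties as ℚ
  import Data.Rational.Unnormalised as ℚᵘ
  import Data.Rational.Unnormalised.Properties as ℚᵘ
  open import Data.Sum using (inj₁; inj₂)
  open import Data.Unit using (tt)
  open import Data.Vec using (Vec; _∷_; zipWith)
  open import Function using (_∘_)
  open import Relation.Binary.PropositionalEquality
  open import Relation.Nullary using (yes; no)

  open import Algebra.Properties.CommutativeSemigroup +-commutativeSemigroup using () renaming (interchange to +-interchange)
  open import Algebra.Properties.CommutativeSemigroup *-commutativeSemigroup using () renaming (x∙yz≈y∙xz to *-left-comm)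

  ^-distribʳ-* : ∀ m n o → (m * n) ^ o ≡ m ^ o * n ^ o
  ^-distribʳ-* m n zero    = refl
  ^-distribʳ-* m n (suc o) = trans (cong (m * n *_) (^-distribʳ-* m n o)) (interchange m n (m ^ o) (n ^ o))
    where interchange : ∀ a b x y → a * b * (x * y) ≡ a * x * (b * y)
          interchange = solve-∀

  m*m≤n*n⇒m≤n : ∀ {m n} → m * m ≤ n * n → m ≤ n
  m*m≤n*n⇒m≤n {m} {n} m*m≤n*n with m ≤? n
  ... | yes m≤n = m≤n
  ... | no  m≰n = ⊥-elim (<⇒≱ (*-mono-< (≰⇒> m≰n) (≰⇒> m≰n)) m*m≤n*n)

  [a∸b]*a^n≤a^[1+n]∸b^[1+n] : ∀ {a b} n → b ≤ a → (a ∸ b) * a ^ n ≤ a ^ suc n ∸ b ^ suc n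
  [a∸b]*a^n≤a^[1+n]∸b^[1+n] {a} {b} n b≤a = begin
    (a ∸ b) * a ^ n        ≡⟨ *-distribʳ-∸ (a ^ n) a b ⟩
    a * a ^ n ∸ b * a ^ n  ≤⟨ ∸-monoʳ-≤ (a * a ^ n) (*-monoʳ-≤ b (^-monoˡ-≤ n b≤a)) ⟩
    a ^ suc n ∸ b ^ suc n  ∎
    where open ≤-Reasoning

  8^n*[8+n]≤8*9^n : ∀ n → 8 ^ n * (8 + n) ≤ 8 * 9 ^ n
  8^n*[8+n]≤8*9^n zero    = ≤-refl
  8^n*[8+n]≤8*9^n (suc n) = begin
    8 * 8 ^ n * (9 + n)               ≤⟨ m≤m+n _ (8 ^ n * n) ⟩
    8 * 8 ^ n * (9 + n) + 8 ^ n * n   ≡⟨ expand (8 ^ n) n ⟩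
    9 * (8 ^ n * (8 + n))             ≤⟨ *-monoʳ-≤ 9 (8^n*[8+n]≤8*9^n n) ⟩
    9 * (8 * 9 ^ n)                   ≡⟨ *-left-comm 9 8 (9 ^ n) ⟩
    8 * (9 * 9 ^ n)                   ∎
    where
    open ≤-Reasoning
    expand : ∀ x n → 8 * x * (9 + n) + x * n ≡ 9 * (x * (8 + n))
    expand = solve-∀

  8a≤n⇒a*8^n<9^n : ∀ {a n} → 8 * a ≤ n → a * 8 ^ n < 9 ^ n
  8a≤n⇒a*8^n<9^n {a} {n} 8a≤n = *-cancelˡ-< 8 _ _ (begin-strict
    8 * (a * 8 ^ n)   ≡⟨ *-assoc 8 a (8 ^ n) ⟨
    8 * a * 8 ^ n     ≤⟨ *-monoˡ-≤ (8 ^ n) 8a≤n ⟩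
    n * 8 ^ n         <⟨ *-monoˡ-< (8 ^ n) {{m^n≢0 8 n}} (m<n+m n {8} (s≤s z≤n)) ⟩
    (8 + n) * 8 ^ n   ≡⟨ *-comm (8 + n) (8 ^ n) ⟩
    8 ^ n * (8 + n)   ≤⟨ 8^n*[8+n]≤8*9^n n ⟩
    8 * 9 ^ n         ∎)
    where open ≤-Reasoning

  2^[n+n]*[2c]^n≡[8c]^n : ∀ c n → 2 ^ (n + n) * (2 * c) ^ n ≡ (8 * c) ^ n
  2^[n+n]*[2c]^n≡[8c]^n c zero    = refl
  2^[n+n]*[2c]^n≡[8c]^n c (suc n) rewrite +-suc n n = trans (regroup (2 ^ (n + n)) ((2 * c) ^ n) c)
                                                        (cong (8 * c *_) (2^[n+n]*[2c]^n≡[8c]^n c n))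
    where regroup : ∀ x y c → 2 * (2 * x) * (2 * c * y) ≡ 8 * c * (x * y)
          regroup = solve-∀

  9[1+c]≤[3+2c]² : ∀ c → 9 * suc c ≤ suc (2 * suc c) * suc (2 * suc c)
  9[1+c]≤[3+2c]² c = subst (9 * suc c ≤_) (expand c) (m≤m+n (9 * suc c) (4 * (c * c) + 3 * c))
    where expand : ∀ c → 9 * (1 + c) + (4 * (c * c) + 3 * c) ≡ (1 + 2 * (1 + c)) * (1 + 2 * (1 + c))
          expand = solve-∀

  sum-map-cong : {A : Set} {f g : A → ℕ} → f ≗ g → ∀ xs → sum (map f xs) ≡ sum (map g xs)
  sum-map-cong f≗g xs = cong sum (map-cong f≗g xs)

  sum-map-mono : {A : Set} {f g : A → ℕ} → (∀ x → f x ≤ g x) → ∀ xs → sum (map f xs) ≤ sum (map g xs)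
  sum-map-mono f≤g []       = z≤n
  sum-map-mono f≤g (x ∷ xs) = +-mono-≤ (f≤g x) (sum-map-mono f≤g xs)

  sum-map-+ : {A : Set} (f g : A → ℕ) → ∀ xs →
              sum (map (λ x → f x + g x) xs) ≡ sum (map f xs) + sum (map g xs)
  sum-map-+ f g []       = refl
  sum-map-+ f g (x ∷ xs) = trans (cong (_+_ (f x + g x)) (sum-map-+ f g xs))
                                 (+-interchange (f x) (g x) (sum (map f xs)) (sum (map g xs)))

  sum-map-*ˡ : {A : Set} (a : ℕ) (f : A → ℕ) → ∀ xs → sum (map (λ x → a * f x) xs) ≡ a * sum (map f xs)
  sum-map-*ˡ a f []       = sym (*-zeroʳ a)
  sum-map-*ˡ a f (x ∷ xs) = trans (cong (_+_ (a * f x)) (sum-map-*ˡ a f xs)) (sym (*-distribˡ-+ a (f x) _))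

  sum-map-const : {A : Set} (a : ℕ) (xs : List A) → sum (map (λ _ → a) xs) ≡ length xs * a
  sum-map-const a []       = refl
  sum-map-const a (x ∷ xs) = cong (_+_ a) (sum-map-const a xs)

  sum-map-concatMap : {A B : Set} (f : B → ℕ) (g : A → List B) → ∀ xs →
                      sum (map f (concatMap g xs)) ≡ sum (map (λ x → sum (map f (g x))) xs)
  sum-map-concatMap f g []       = refl
  sum-map-concatMap f g (x ∷ xs) = begin
    sum (map f (g x ++ concatMap g xs))              ≡⟨ cong sum (map-++ f (g x) _) ⟩
    sum (map f (g x) ++ map f (concatMap g xs))      ≡⟨ sum-++ (map f (g x)) _ ⟩
    sum (map f (g x)) + sum (map f (concatMap g xs)) ≡⟨ cong (_+_ (sum (map f (g x)))) (sum-map-concatMap f g xs) ⟩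
    sum (map f (g x)) + sum (map (λ x → sum (map f (g x))) xs) ∎
    where open ≡-Reasoning

  length-concatMap : {A B : Set} (g : A → List B) → ∀ xs → length (concatMap g xs) ≡ sum (map (length ∘ g) xs)
  length-concatMap g []       = refl
  length-concatMap g (x ∷ xs) = trans (length-++ (g x)) (cong (_+_ (length (g x))) (length-concatMap g xs))

  sum-applyUpTo-paired : ∀ c (h : ℕ → ℕ) {A B} → (∀ i → h i ≤ A) → (∀ i → h i + h (suc i) ≤ B) →
                         sum (applyUpTo h (suc (c + c))) ≤ c * B + A
  sum-applyUpTo-paired zero    h {A}     h≤A _   = ≤-trans (≤-reflexive (+-identityʳ (h 0))) (h≤A 0)
  sum-applyUpTo-paired (suc c) h {A} {B} h≤A h≤B rewrite +-suc c c = begin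
    h 0 + (h 1 + rest)  ≡⟨ +-assoc (h 0) (h 1) rest ⟨
    h 0 + h 1 + rest    ≤⟨ +-mono-≤ (h≤B 0) (sum-applyUpTo-paired c (h ∘ suc ∘ suc) (h≤A ∘ suc ∘ suc) (h≤B ∘ suc ∘ suc)) ⟩
    B + (c * B + A)     ≡⟨ +-assoc B (c * B) A ⟨
    suc c * B + A       ∎
    where open ≤-Reasoning
          rest = sum (applyUpTo (h ∘ suc ∘ suc) (suc (c + c)))

  [k+1]*[n+1]C[k+1]≡[n+1]*nCk : ∀ n k → suc k * (suc n C suc k) ≡ suc n * (n C k)
  [k+1]*[n+1]C[k+1]≡[n+1]*nCk zero    zero    = refl
  [k+1]*[n+1]C[k+1]≡[n+1]*nCk zero    (suc k) = *-zeroʳ (suc (suc k))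
  [k+1]*[n+1]C[k+1]≡[n+1]*nCk (suc n) zero    =
    trans (+-identityʳ _) (trans (nC1≡n (suc (suc n))) (sym (*-identityʳ (suc (suc n)))))
  [k+1]*[n+1]C[k+1]≡[n+1]*nCk (suc n) (suc k) = begin
    suc (suc k) * (suc (suc n) C suc (suc k))
      ≡⟨ cong (suc (suc k) *_) (nCk+nC[k+1]≡[n+1]C[k+1] (suc n) (suc k)) ⟨
    suc (suc k) * (x + y)
      ≡⟨ split k x y ⟩
    x + (suc k * x + suc (suc k) * y)
      ≡⟨ cong₂ (λ u v → x + (u + v)) ([k+1]*[n+1]C[k+1]≡[n+1]*nCk n k) ([k+1]*[n+1]C[k+1]≡[n+1]*nCk n (suc k)) ⟩
    x + (suc n * (n C k) + suc n * (n C suc k))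
      ≡⟨ cong (_+_ x) (sym (*-distribˡ-+ (suc n) (n C k) (n C suc k))) ⟩
    x + suc n * (n C k + n C suc k)
      ≡⟨ cong (λ z → x + suc n * z) (nCk+nC[k+1]≡[n+1]C[k+1] n k) ⟩
    suc (suc n) * x ∎
    where open ≡-Reasoning
          x = suc n C suc k
          y = suc n C suc (suc k)
          split : ∀ k x y → suc (suc k) * (x + y) ≡ x + (suc k * x + suc (suc k) * y)
          split = solve-∀

  [k+1]*nC[k+1]≡[n∸k]*nCk : ∀ n k → suc k * (n C suc k) ≡ (n ∸ k) * (n C k)
  [k+1]*nC[k+1]≡[n∸k]*nCk n k = begin
    suc k * (n C suc k)                                   ≡⟨ m+n∸n≡m _ (suc k * (n C k)) ⟨
    suc k * (n C suc k) + suc k * (n C k) ∸ suc k * (n C k) ≡⟨ cong (_∸ suc k * (n C k)) pascal-absorbed ⟩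
    suc n * (n C k) ∸ suc k * (n C k)                       ≡⟨ *-distribʳ-∸ (n C k) (suc n) (suc k) ⟨
    (n ∸ k) * (n C k)                                       ∎
    where
    open ≡-Reasoning
    pascal-absorbed : suc k * (n C suc k) + suc k * (n C k) ≡ suc n * (n C k)
    pascal-absorbed = begin
      suc k * (n C suc k) + suc k * (n C k) ≡⟨ *-distribˡ-+ (suc k) (n C suc k) (n C k) ⟨
      suc k * (n C suc k + n C k)           ≡⟨ cong (suc k *_) (+-comm (n C suc k) (n C k)) ⟩
      suc k * (n C k + n C suc k)           ≡⟨ cong (suc k *_) (nCk+nC[k+1]≡[n+1]C[k+1] n k) ⟩
      suc k * (suc n C suc k)               ≡⟨ [k+1]*[n+1]C[k+1]≡[n+1]*nCk n k ⟩
      suc n * (n C k)                       ∎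

  nCk≤nC[k+1] : ∀ {n k} → suc k + k ≤ n → n C k ≤ n C suc k
  nCk≤nC[k+1] {n} {k} 2k<n = *-cancelˡ-≤ (suc k) (begin
    suc k * (n C k)       ≤⟨ *-monoˡ-≤ (n C k) (m+n≤o⇒m≤o∸n (suc k) 2k<n) ⟩
    (n ∸ k) * (n C k)     ≡⟨ [k+1]*nC[k+1]≡[n∸k]*nCk n k ⟨
    suc k * (n C suc k)   ∎)
    where open ≤-Reasoning

  nC[k+1]≤nCk : ∀ {n k} → n ≤ k + suc k → n C suc k ≤ n C k
  nC[k+1]≤nCk {n} {k} n≤2k+1 = *-cancelˡ-≤ (suc k) (begin
    suc k * (n C suc k)   ≡⟨ [k+1]*nC[k+1]≡[n∸k]*nCk n k ⟩
    (n ∸ k) * (n C k)     ≤⟨ *-monoˡ-≤ (n C k) (m≤n+o⇒m∸n≤o n k n≤2k+1) ⟩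
    suc k * (n C k)       ∎)
    where open ≤-Reasoning

  ≤-peak : (f : ℕ → ℕ) (h : ℕ) → (∀ {k} → suc k ≤ h → f k ≤ f (suc k)) →
           (∀ {k} → h ≤ k → f (suc k) ≤ f k) → ∀ k → f k ≤ f h
  ≤-peak f h rising falling k with ≤-total k h
  ... | inj₁ k≤h = below (h ∸ k) k (m+[n∸m]≡n k≤h)
    where
    below : ∀ d k → k + d ≡ h → f k ≤ f h
    below zero    k k+0≡h = ≤-reflexive (cong f (trans (sym (+-identityʳ k)) k+0≡h))
    below (suc d) k k+d≡h = ≤-trans (rising (subst (suc k ≤_) k+d≡h (m<m+n k (s≤s z≤n))))
                                    (below d (suc k) (trans (sym (+-suc k d)) k+d≡h))
  ... | inj₂ h≤k = subst (λ j → f j ≤ f h) (m+[n∸m]≡n h≤k) (above (k ∸ h))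
    where
    above : ∀ d → f (h + d) ≤ f h
    above zero    = ≤-reflexive (cong f (+-identityʳ h))
    above (suc d) = ≤-trans (≤-trans (≤-reflexive (cong f (+-suc h d))) (falling (m≤m+n h d))) (above d)

  central : ℕ → ℕ
  central n = n C ⌊ n /2⌋

  ⌊n/2⌋+⌊n/2⌋≤n : ∀ n → ⌊ n /2⌋ + ⌊ n /2⌋ ≤ n
  ⌊n/2⌋+⌊n/2⌋≤n zero          = z≤n
  ⌊n/2⌋+⌊n/2⌋≤n (suc zero)    = z≤n
  ⌊n/2⌋+⌊n/2⌋≤n (suc (suc n)) = s≤s (≤-trans (≤-reflexive (+-suc _ _)) (s≤s (⌊n/2⌋+⌊n/2⌋≤n n)))

  n≤⌊n/2⌋+[1+⌊n/2⌋] : ∀ n → n ≤ ⌊ n /2⌋ + suc ⌊ n /2⌋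
  n≤⌊n/2⌋+[1+⌊n/2⌋] zero          = z≤n
  n≤⌊n/2⌋+[1+⌊n/2⌋] (suc zero)    = s≤s z≤n
  n≤⌊n/2⌋+[1+⌊n/2⌋] (suc (suc n)) = s≤s (≤-trans (s≤s (n≤⌊n/2⌋+[1+⌊n/2⌋] n)) (≤-reflexive (sym (+-suc _ _))))

  nCk≤central : ∀ n k → n C k ≤ central n
  nCk≤central n = ≤-peak (n C_) ⌊ n /2⌋ rising falling
    where
    rising : ∀ {k} → suc k ≤ ⌊ n /2⌋ → n C k ≤ n C suc k
    rising {k} k<h = nCk≤nC[k+1] (≤-trans (+-mono-≤ k<h (≤-trans (n≤1+n k) k<h)) (⌊n/2⌋+⌊n/2⌋≤n n))
    falling : ∀ {k} → ⌊ n /2⌋ ≤ k → n C suc k ≤ n C k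
    falling {k} h≤k = nC[k+1]≤nCk (≤-trans (n≤⌊n/2⌋+[1+⌊n/2⌋] n) (+-mono-≤ h≤k (s≤s h≤k)))

  central[n+1]≤2*central[n] : ∀ n → central (suc n) ≤ 2 * central n
  central[n+1]≤2*central[n] n with ⌊ suc n /2⌋
  ... | zero  = ≤-trans (nCk≤central n 0) (m≤m+n _ _)
  ... | suc k = begin
    suc n C suc k              ≡⟨ nCk+nC[k+1]≡[n+1]C[k+1] n k ⟨
    n C k + n C suc k          ≤⟨ +-mono-≤ (nCk≤central n k) (≤-trans (nCk≤central n (suc k)) (m≤m+n _ 0)) ⟩
    central n + (central n + 0) ∎
    where open ≤-Reasoning

  2^m*central[n]≤2^n*central[m] : ∀ {m n} → m ≤ n → 2 ^ m * central n ≤ 2 ^ n * central m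
  2^m*central[n]≤2^n*central[m] {m} {n} m≤n =
    subst (λ n → 2 ^ m * central n ≤ 2 ^ n * central m) (m+[n∸m]≡n m≤n) (extend (n ∸ m))
    where
    extend : ∀ d → 2 ^ m * central (m + d) ≤ 2 ^ (m + d) * central m
    extend zero    rewrite +-identityʳ m = ≤-refl
    extend (suc d) rewrite +-suc m d = begin
      2 ^ m * central (suc (m + d))  ≤⟨ *-monoʳ-≤ (2 ^ m) (central[n+1]≤2*central[n] (m + d)) ⟩
      2 ^ m * (2 * central (m + d))  ≡⟨ *-left-comm (2 ^ m) 2 (central (m + d)) ⟩
      2 * (2 ^ m * central (m + d))  ≤⟨ *-monoʳ-≤ 2 (extend d) ⟩
      2 * (2 ^ (m + d) * central m)  ≡⟨ *-assoc 2 (2 ^ (m + d)) (central m) ⟨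
      2 ^ suc (m + d) * central m    ∎
      where open ≤-Reasoning

  [2t+1]C[t+1]≡[2t+1]Ct : ∀ t → suc (t + t) C suc t ≡ suc (t + t) C t
  [2t+1]C[t+1]≡[2t+1]Ct t = *-cancelˡ-≡ _ _ (suc t) (begin
    suc t * (suc (t + t) C suc t)       ≡⟨ [k+1]*nC[k+1]≡[n∸k]*nCk (suc (t + t)) t ⟩
    (suc t + t ∸ t) * (suc (t + t) C t) ≡⟨ cong (_* (suc (t + t) C t)) (m+n∸n≡m (suc t) t) ⟩
    suc t * (suc (t + t) C t)           ∎)
    where open ≡-Reasoning

  [t+1]*[2t+2]C[t+1]≡2*[2t+1]*[2t]Ct : ∀ t → suc t * (suc (suc (t + t)) C suc t) ≡ 2 * (suc (t + t) * ((t + t) C t))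
  [t+1]*[2t+2]C[t+1]≡2*[2t+1]*[2t]Ct t = begin
    suc t * (suc (suc (t + t)) C suc t)        ≡⟨ cong (suc t *_) (nCk+nC[k+1]≡[n+1]C[k+1] (suc (t + t)) t) ⟨
    suc t * (suc (t + t) C t + x)              ≡⟨ cong (λ z → suc t * (z + x)) ([2t+1]C[t+1]≡[2t+1]Ct t) ⟨
    suc t * (x + x)                            ≡⟨ double (suc t) x ⟩
    2 * (suc t * x)                            ≡⟨ cong (2 *_) ([k+1]*[n+1]C[k+1]≡[n+1]*nCk (t + t) t) ⟩
    2 * (suc (t + t) * ((t + t) C t))          ∎
    where
    open ≡-Reasoning
    x = suc (t + t) C suc t
    double : ∀ a x → a * (x + x) ≡ 2 * (a * x)
    double = solve-∀

  [2t]Ct²*[2t+1]≤4^[2t] : ∀ t → ((t + t) C t) * ((t + t) C t) * suc (t + t) ≤ 4 ^ (t + t)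
  [2t]Ct²*[2t+1]≤4^[2t] zero    = ≤-refl
  [2t]Ct²*[2t+1]≤4^[2t] (suc t) rewrite +-suc t t = *-cancelˡ-≤ (suc t * suc t) (begin
    (suc t * suc t) * (a′ * a′ * (2 + s))           ≡⟨ regroup (suc t) a′ (2 + s) ⟩
    (suc t * a′) * (suc t * a′) * (2 + s)           ≡⟨ cong (λ z → z * z * (2 + s)) ([t+1]*[2t+2]C[t+1]≡2*[2t+1]*[2t]Ct t) ⟩
    (2 * (s * a)) * (2 * (s * a)) * (2 + s)         ≡⟨ expand s a ⟩
    (4 * (s * (2 + s))) * (a * a * s)               ≤⟨ *-monoʳ-≤ (4 * (s * (2 + s))) ([2t]Ct²*[2t+1]≤4^[2t] t) ⟩
    (4 * (s * (2 + s))) * 4 ^ (t + t)               ≤⟨ *-monoˡ-≤ (4 ^ (t + t)) (subst (4 * (s * (2 + s)) ≤_) (square t) (m≤m+n _ 4)) ⟩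
    16 * (suc t * suc t) * 4 ^ (t + t)              ≡⟨ reassociate (suc t * suc t) (4 ^ (t + t)) ⟩
    (suc t * suc t) * (4 * (4 * 4 ^ (t + t)))       ∎)
    where
    open ≤-Reasoning
    a = (t + t) C t
    a′ = suc (suc (t + t)) C suc t
    s = suc (t + t)
    regroup : ∀ u a′ w → (u * u) * (a′ * a′ * w) ≡ (u * a′) * (u * a′) * w
    regroup = solve-∀
    expand : ∀ s a → (2 * (s * a)) * (2 * (s * a)) * (2 + s) ≡ (4 * (s * (2 + s))) * (a * a * s)
    expand = solve-∀
    square : ∀ t → 4 * ((1 + (t + t)) * (2 + (1 + (t + t)))) + 4 ≡ 16 * ((1 + t) * (1 + t))
    square = solve-∀
    reassociate : ∀ x y → 16 * x * y ≡ x * (4 * (4 * y))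
    reassociate = solve-∀

  a*central[2t]≤2^[2t] : ∀ t a → a * a ≤ suc (t + t) → a * central (t + t) ≤ 2 ^ (t + t)
  a*central[2t]≤2^[2t] t a a²≤2t+1 rewrite sym (n≡⌊n+n/2⌋ t) = m*m≤n*n⇒m≤n (begin
    (a * b) * (a * b)             ≡⟨ regroup a b ⟩
    (a * a) * (b * b)             ≤⟨ *-monoˡ-≤ (b * b) a²≤2t+1 ⟩
    suc (t + t) * (b * b)         ≡⟨ *-comm (suc (t + t)) (b * b) ⟩
    b * b * suc (t + t)           ≤⟨ [2t]Ct²*[2t+1]≤4^[2t] t ⟩
    (2 * 2) ^ (t + t)             ≡⟨ ^-distribʳ-* 2 2 (t + t) ⟩
    2 ^ (t + t) * 2 ^ (t + t)     ∎)
    where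
    open ≤-Reasoning
    b = (t + t) C t
    regroup : ∀ a b → (a * b) * (a * b) ≡ (a * a) * (b * b)
    regroup = solve-∀

  flips : ℕ → (ℤ → ℕ) → ℤ → ℕ
  flips zero    g   = g
  flips (suc P) g y = flips P g y + flips P g (y ℤ.+ + 1)

  walks : ℕ → ℕ → (ℤ → ℕ) → ℤ → ℕ
  walks c zero    g   = g
  walks c (suc m) g y = sum (map (λ s → walks c m g (y ℤ.+ s)) (range c))

  +-shift-comm : ∀ (y s e : ℤ) → (y ℤ.+ s) ℤ.+ e ≡ (y ℤ.+ e) ℤ.+ s
  +-shift-comm = ℤ-Solver.solve-∀

  walks-+ : ∀ c m (f g : ℤ → ℕ) y → walks c m (λ z → f z + g z) y ≡ walks c m f y + walks c m g y
  walks-+ c zero    f g y = refl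
  walks-+ c (suc m) f g y = trans (sum-map-cong (λ s → walks-+ c m f g (y ℤ.+ s)) (range c))
                                  (sum-map-+ (λ s → walks c m f (y ℤ.+ s)) (λ s → walks c m g (y ℤ.+ s)) (range c))

  walks-shift : ∀ c m (g : ℤ → ℕ) e y → walks c m (λ z → g (z ℤ.+ e)) y ≡ walks c m g (y ℤ.+ e)
  walks-shift c zero    g e y = refl
  walks-shift c (suc m) g e y = sum-map-cong
    (λ s → trans (walks-shift c m g e (y ℤ.+ s)) (cong (walks c m g) (+-shift-comm y s e))) (range c)

  walks-flips-suc : ∀ c m P g y → walks c m (flips (suc P) g) y ≡ walks c m (flips P g) y + walks c m (flips P g) (y ℤ.+ + 1)
  walks-flips-suc c m P g y = trans (walks-+ c m (flips P g) (λ z → flips P g (z ℤ.+ + 1)) y)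
                                    (cong (_+_ (walks c m (flips P g) y)) (walks-shift c m (flips P g) (+ 1) y))

  flips-+ : ∀ P (f g : ℤ → ℕ) y → flips P (λ z → f z + g z) y ≡ flips P f y + flips P g y
  flips-+ zero    f g y = refl
  flips-+ (suc P) f g y rewrite flips-+ P f g y | flips-+ P f g (y ℤ.+ + 1) =
    +-interchange (flips P f y) (flips P g y) (flips P f (y ℤ.+ + 1)) (flips P g (y ℤ.+ + 1))

  flips-shift : ∀ P (g : ℤ → ℕ) e y → flips P (λ z → g (z ℤ.+ e)) y ≡ flips P g (y ℤ.+ e)
  flips-shift zero    g e y = refl
  flips-shift (suc P) g e y rewrite flips-shift P g e y | flips-shift P g e (y ℤ.+ + 1) =
    cong (_+_ (flips P g (y ℤ.+ e))) (cong (flips P g) (+-shift-comm y (+ 1) e))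

  flips-mono : ∀ P {f g : ℤ → ℕ} → (∀ z → f z ≤ g z) → ∀ y → flips P f y ≤ flips P g y
  flips-mono zero    f≤g y = f≤g y
  flips-mono (suc P) f≤g y = +-mono-≤ (flips-mono P f≤g y) (flips-mono P f≤g (y ℤ.+ + 1))

  flips-≤ : ∀ P {g : ℤ → ℕ} {A} → (∀ z → g z ≤ A) → ∀ y → flips P g y ≤ 2 ^ P * A
  flips-≤ zero    {A = A} g≤A y = ≤-trans (g≤A y) (≤-reflexive (sym (+-identityʳ A)))
  flips-≤ (suc P) {A = A} g≤A y = ≤-trans (+-mono-≤ (flips-≤ P g≤A y) (flips-≤ P g≤A (y ℤ.+ + 1)))
                                          (≤-reflexive (twice (2 ^ P) A))
    where twice : ∀ x a → x * a + x * a ≡ (2 * x) * a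
          twice = solve-∀

  sum-range-paired : ∀ c (h : ℤ → ℕ) {A B} → (∀ z → h z ≤ A) → (∀ z → h z + h (z ℤ.+ + 1) ≤ B) →
                     ∀ y → sum (map (λ s → h (y ℤ.+ s)) (range c)) ≤ c * B + A
  sum-range-paired c h {A} {B} h≤A h≤B y = begin
    sum (map (λ s → h (y ℤ.+ s)) (range c))             ≡⟨ cong sum (map-∘ (upTo (suc (2 * c)))) ⟨
    sum (map hᵢ (upTo (suc (2 * c))))                    ≡⟨ cong sum (map-upTo hᵢ (suc (2 * c))) ⟩
    sum (applyUpTo hᵢ (suc (2 * c)))                     ≡⟨ cong (λ n → sum (applyUpTo hᵢ (suc (c + n)))) (+-identityʳ c) ⟩
    sum (applyUpTo hᵢ (suc (c + c)))                     ≤⟨ sum-applyUpTo-paired c hᵢ (λ i → h≤A _) hᵢ-pair ⟩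
    c * B + A                                            ∎
    where
    open ≤-Reasoning
    hᵢ : ℕ → ℕ
    hᵢ i = h (y ℤ.+ (+ i ℤ.- + c))
    next : ∀ y a b → y ℤ.+ ((+ 1 ℤ.+ a) ℤ.- b) ≡ (y ℤ.+ (a ℤ.- b)) ℤ.+ + 1
    next = ℤ-Solver.solve-∀
    hᵢ-pair : ∀ i → hᵢ i + hᵢ (suc i) ≤ B
    hᵢ-pair i = subst (λ z → hᵢ i + h z ≤ B) (sym (next y (+ i) (+ c))) (h≤B _)

  -- Pairing the offsets -c+2i and -c+2i+1 turns one uniform step on [-c, c] into c coin flips
  -- and one lone offset, whence the recursion for B.
  walks-flips-bound : ∀ c a (g : ℤ → ℕ) (B : ℕ → ℕ → ℕ) →
    (∀ P y → a * flips P g y ≤ B 0 P) →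
    (∀ m P → c * B m (suc P) + B m P ≤ B (suc m) P) →
    ∀ m P y → a * walks c m (flips P g) y ≤ B m P
  walks-flips-bound c a g B base step zero    P y = base P y
  walks-flips-bound c a g B base step (suc m) P y = begin
    a * sum (map (λ s → W P (y ℤ.+ s)) (range c))     ≡⟨ sum-map-*ˡ a (λ s → W P (y ℤ.+ s)) (range c) ⟨
    sum (map (λ s → a * W P (y ℤ.+ s)) (range c))     ≤⟨ sum-range-paired c (λ z → a * W P z)
                                                           (walks-flips-bound c a g B base step m P) paired y ⟩
    c * B m (suc P) + B m P                           ≤⟨ step m P ⟩
    B (suc m) P                                       ∎
    where
    open ≤-Reasoning
    W : ℕ → ℤ → ℕ
    W P = walks c m (flips P g)
    paired : ∀ z → a * W P z + a * W P (z ℤ.+ + 1) ≤ B m (suc P)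
    paired z = subst (_≤ B m (suc P)) (trans (cong (a *_) (walks-flips-suc c m P g z)) (*-distribˡ-+ a _ _))
                     (walks-flips-bound c a g B base step m (suc P) z)

  point : ℤ → ℕ
  point (+ zero)  = 1
  point (+ suc _) = 0
  point -[1+ _ ]  = 0

  flips-point-pos : ∀ P j → flips P point (+ suc j) ≡ 0
  flips-point-pos zero    j = refl
  flips-point-pos (suc P) j rewrite flips-point-pos P j | flips-point-pos P (j + 1) = refl

  flips-point-0 : ∀ P → flips P point (+ 0) ≡ 1
  flips-point-0 zero    = refl
  flips-point-0 (suc P) rewrite flips-point-0 P | flips-point-pos P 0 = refl

  flips-point-neg : ∀ P j → flips P point -[1+ j ] ≡ P C suc j
  flips-point-neg zero    j       = refl
  flips-point-neg (suc P) zero    rewrite flips-point-neg P 0 | flips-point-0 P =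
    trans (+-comm (P C 1) 1) (nCk+nC[k+1]≡[n+1]C[k+1] P 0)
  flips-point-neg (suc P) (suc j) rewrite flips-point-neg P (suc j) | flips-point-neg P j =
    trans (+-comm (P C suc (suc j)) (P C suc j)) (nCk+nC[k+1]≡[n+1]C[k+1] P (suc j))

  flips-point≤central : ∀ P y → flips P point y ≤ central P
  flips-point≤central P (+ zero)  rewrite flips-point-0 P   = nCk≤central P 0
  flips-point≤central P (+ suc j) rewrite flips-point-pos P j = z≤n
  flips-point≤central P -[1+ j ]  rewrite flips-point-neg P j = nCk≤central P (suc j)

  interval : ℤ → ℕ → ℤ → ℕ
  interval a zero    y = 0
  interval a (suc ℓ) y = point (y ℤ.- a) + interval (a ℤ.+ + 1) ℓ y

  flips-interval≤ : ∀ P a ℓ y → flips P (interval a ℓ) y ≤ ℓ * central P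
  flips-interval≤ P a zero    y = ≤-trans (flips-≤ P (λ _ → z≤n) y) (≤-reflexive (*-zeroʳ (2 ^ P)))
  flips-interval≤ P a (suc ℓ) y = begin
    flips P (interval a (suc ℓ)) y
      ≡⟨ flips-+ P (λ z → point (z ℤ.- a)) (interval (a ℤ.+ + 1) ℓ) y ⟩
    flips P (λ z → point (z ℤ.- a)) y + flips P (interval (a ℤ.+ + 1) ℓ) y
      ≡⟨ cong (_+ flips P (interval (a ℤ.+ + 1) ℓ) y) (flips-shift P point (ℤ.- a) y) ⟩
    flips P point (y ℤ.- a) + flips P (interval (a ℤ.+ + 1) ℓ) y
      ≤⟨ +-mono-≤ (flips-point≤central P (y ℤ.- a)) (flips-interval≤ P (a ℤ.+ + 1) ℓ y) ⟩
    central P + ℓ * central P ∎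
    where open ≤-Reasoning

  interval-covers : ∀ a ℓ j → j < ℓ → 1 ≤ interval a ℓ (a ℤ.+ + j)
  interval-covers a (suc ℓ) zero    _ = subst (λ z → 1 ≤ point z + interval (a ℤ.+ + 1) ℓ (a ℤ.+ + 0)) (sym (cancel a)) (s≤s z≤n)
    where cancel : ∀ a → a ℤ.+ + 0 ℤ.- a ≡ + 0
          cancel = ℤ-Solver.solve-∀
  interval-covers a (suc ℓ) (suc j) (s≤s j<ℓ) = subst (λ z → 1 ≤ interval a (suc ℓ) z) (sym (step a (+ j)))
    (≤-trans (interval-covers (a ℤ.+ + 1) ℓ j j<ℓ) (m≤n+m _ _))
    where step : ∀ a j → a ℤ.+ (+ 1 ℤ.+ j) ≡ (a ℤ.+ + 1) ℤ.+ j
          step = ℤ-Solver.solve-∀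

  ball : ℕ → ℤ → ℕ
  ball k y = if ∣ y ∣ ℕ.<ᵇ k then 1 else 0

  ball≤interval : ∀ k y → ball k y ≤ interval (ℤ.- + k) (k + k) y
  ball≤interval k y with ∣ y ∣ ℕ.<ᵇ k in ∣y∣<ᵇk
  ... | false = z≤n
  ... | true  = covered y (<ᵇ⇒< ∣ y ∣ k (subst Bool.T (sym ∣y∣<ᵇk) tt))
    where
    covered : ∀ y → ∣ y ∣ < k → 1 ≤ interval (ℤ.- + k) (k + k) y
    covered (+ n) n<k = subst (λ z → 1 ≤ interval (ℤ.- + k) (k + k) z) (cancel (+ k) (+ n))
                              (interval-covers (ℤ.- + k) (k + k) (k + n) (+-monoʳ-< k n<k))
      where cancel : ∀ K N → ℤ.- K ℤ.+ (K ℤ.+ N) ≡ N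
            cancel = ℤ-Solver.solve-∀
    covered -[1+ n ] n<k = subst (λ z → 1 ≤ interval (ℤ.- + k) (k + k) z) eq
                                 (interval-covers (ℤ.- + k) (k + k) j (≤-trans j<k (m≤m+n k k)))
      where
      j = k ∸ suc n
      n+j≡k : suc n + j ≡ k
      n+j≡k = m+[n∸m]≡n (<⇒≤ n<k)
      j<k : j < k
      j<k = subst (j <_) n+j≡k (m<n+m j (s≤s z≤n))
      cancel : ∀ N J → ℤ.- (N ℤ.+ J) ℤ.+ J ≡ ℤ.- N
      cancel = ℤ-Solver.solve-∀
      eq : ℤ.- + k ℤ.+ + j ≡ -[1+ n ]
      eq = subst (λ m → ℤ.- + m ℤ.+ + j ≡ -[1+ n ]) n+j≡k (cancel (+ suc n) (+ j))

  flips-ball≤ : ∀ P k y → flips P (ball k) y ≤ (k + k) * central P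
  flips-ball≤ P k y = ≤-trans (flips-mono P (ball≤interval k) y) (flips-interval≤ P (ℤ.- + k) (k + k) y)

  shortfall : ℕ → ℕ → ℕ → ℕ
  shortfall c zero    P       = 0
  shortfall c (suc T) zero    = (2 * c) ^ suc T
  shortfall c (suc T) (suc P) = shortfall c T P

  shortfall-0≤ : ∀ c T → shortfall c T 0 ≤ (2 * c) ^ T
  shortfall-0≤ c zero    = z≤n
  shortfall-0≤ c (suc T) = ≤-refl

  shortfall-suc : ∀ c T P → 2 * c * shortfall c T (suc P) ≤ shortfall c T P
  shortfall-suc c zero    P       = ≤-reflexive (*-zeroʳ (2 * c))
  shortfall-suc c (suc T) zero    = *-monoʳ-≤ (2 * c) (shortfall-0≤ c T)
  shortfall-suc c (suc T) (suc P) = shortfall-suc c T P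

  shortfall-pos : ∀ {c} → 1 ≤ c → ∀ {T P} → P < T → 1 ≤ shortfall c T P
  shortfall-pos {c} 1≤c {suc T} {zero}  _         = ≤-trans (≤-reflexive (sym (^-zeroˡ (suc T))))
                                                            (^-monoˡ-≤ (suc T) (≤-trans 1≤c (m≤m+n c (c + 0))))
  shortfall-pos     1≤c {suc T} {suc P} (s≤s P<T) = shortfall-pos 1≤c P<T

  -- With P coins already tossed and m steps to go: the shortfall term covers the event that fewer
  -- than T coins are tossed in all, the central term the window probability 2k C(T,T/2)/2^T otherwise.
  walkBound : ℕ → ℕ → ℕ → ℕ → ℕ → ℕ
  walkBound c k T m P = 2 ^ P * (2 ^ T * (2 ^ m * shortfall c T P) + (k + k) * central T * suc (2 * c) ^ m)

  walkBound-base : ∀ {c} → 1 ≤ c → ∀ k T P y → 2 ^ T * flips P (ball k) y ≤ walkBound c k T 0 P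
  walkBound-base {c} 1≤c k T P y with P <? T
  ... | yes P<T = begin
    2 ^ T * flips P (ball k) y             ≤⟨ *-monoʳ-≤ (2 ^ T) (flips-≤ P ball≤1 y) ⟩
    2 ^ T * (2 ^ P * 1)                    ≡⟨ swap (2 ^ T) (2 ^ P) ⟩
    2 ^ P * (2 ^ T * 1)                    ≤⟨ *-monoʳ-≤ (2 ^ P) (*-monoʳ-≤ (2 ^ T) (shortfall-pos 1≤c P<T)) ⟩
    2 ^ P * (2 ^ T * shortfall c T P)      ≡⟨ cong (λ x → 2 ^ P * (2 ^ T * x)) (*-identityˡ _) ⟨
    2 ^ P * (2 ^ T * (1 * shortfall c T P)) ≤⟨ *-monoʳ-≤ (2 ^ P) (m≤m+n _ _) ⟩
    walkBound c k T 0 P                    ∎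
    where
    open ≤-Reasoning
    ball≤1 : ∀ z → ball k z ≤ 1
    ball≤1 z with ∣ z ∣ ℕ.<ᵇ k
    ... | true  = ≤-refl
    ... | false = z≤n
    swap : ∀ x y → x * (y * 1) ≡ y * (x * 1)
    swap = solve-∀
  ... | no P≮T = begin
    2 ^ T * flips P (ball k) y             ≤⟨ *-monoʳ-≤ (2 ^ T) (flips-ball≤ P k y) ⟩
    2 ^ T * ((k + k) * central P)          ≡⟨ *-left-comm (2 ^ T) (k + k) (central P) ⟩
    (k + k) * (2 ^ T * central P)          ≤⟨ *-monoʳ-≤ (k + k) (2^m*central[n]≤2^n*central[m] (≮⇒≥ P≮T)) ⟩
    (k + k) * (2 ^ P * central T)          ≡⟨ swap (k + k) (2 ^ P) (central T) ⟩
    2 ^ P * ((k + k) * central T * 1)      ≤⟨ *-monoʳ-≤ (2 ^ P) (m≤n+m _ _) ⟩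
    walkBound c k T 0 P                    ∎
    where
    open ≤-Reasoning
    swap : ∀ x y z → x * (y * z) ≡ y * (x * z * 1)
    swap = solve-∀

  walkBound-step : ∀ c k T m P → c * walkBound c k T m (suc P) + walkBound c k T m P ≤ walkBound c k T (suc m) P
  walkBound-step c k T m P = begin
    c * walkBound c k T m (suc P) + walkBound c k T m P
      ≡⟨ collect c (2 ^ P) (2 ^ T) (2 ^ m) (shortfall c T P) (shortfall c T (suc P)) ((k + k) * central T) (suc (2 * c) ^ m) ⟩
    2 ^ P * (2 ^ T * (2 ^ m * (2 * c * shortfall c T (suc P) + shortfall c T P)) + suc (2 * c) * ((k + k) * central T * suc (2 * c) ^ m))
      ≤⟨ *-monoʳ-≤ (2 ^ P) (+-monoˡ-≤ _ (*-monoʳ-≤ (2 ^ T) (*-monoʳ-≤ (2 ^ m) (+-monoˡ-≤ _ (shortfall-suc c T P))))) ⟩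
    2 ^ P * (2 ^ T * (2 ^ m * (shortfall c T P + shortfall c T P)) + suc (2 * c) * ((k + k) * central T * suc (2 * c) ^ m))
      ≡⟨ regroup c (2 ^ P) (2 ^ T) (2 ^ m) (shortfall c T P) ((k + k) * central T) (suc (2 * c) ^ m) ⟩
    walkBound c k T (suc m) P ∎
    where
    open ≤-Reasoning
    collect : ∀ c q X u e₀ e₁ Y w →
      c * (2 * q * (X * (u * e₁) + Y * w)) + q * (X * (u * e₀) + Y * w) ≡ q * (X * (u * (2 * c * e₁ + e₀)) + (1 + 2 * c) * (Y * w))
    collect = solve-∀
    regroup : ∀ c q X u e₀ Y w →
      q * (X * (u * (e₀ + e₀)) + (1 + 2 * c) * (Y * w)) ≡ q * (X * (2 * u * e₀) + Y * ((1 + 2 * c) * w))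
    regroup = solve-∀

  walks-ball≤ : ∀ {c} → 1 ≤ c → ∀ k T m y →
    2 ^ T * walks c m (ball k) y ≤ 2 ^ T * (2 ^ m * (2 * c) ^ T) + (k + k) * central T * suc (2 * c) ^ m
  walks-ball≤ {c} 1≤c k T m y = begin
    2 ^ T * walks c m (ball k) y
       ≤⟨ walks-flips-bound c (2 ^ T) (ball k) (walkBound c k T) (walkBound-base 1≤c k T) (walkBound-step c k T) m 0 y ⟩
    1 * (2 ^ T * (2 ^ m * shortfall c T 0) + (k + k) * central T * suc (2 * c) ^ m)
       ≡⟨ *-identityˡ _ ⟩
    2 ^ T * (2 ^ m * shortfall c T 0) + (k + k) * central T * suc (2 * c) ^ m
       ≤⟨ +-monoˡ-≤ _ (*-monoʳ-≤ (2 ^ T) (*-monoʳ-≤ (2 ^ m) (shortfall-0≤ c T))) ⟩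
    2 ^ T * (2 ^ m * (2 * c) ^ T) + (k + k) * central T * suc (2 * c) ^ m ∎
    where open ≤-Reasoning

  a*2^N*[2c]^T<[2c+1]^N : ∀ c {a T N} → 8 * a ≤ T → T + T ≤ N → a * (2 ^ N * (2 * suc c) ^ T) < suc (2 * suc c) ^ N
  a*2^N*[2c]^T<[2c+1]^N c {a} {T} {N} 8a≤T 2T≤N rewrite sym (m+[n∸m]≡n 2T≤N) = begin-strict
    a * (2 ^ (T + T + e) * (2 * suc c) ^ T)          ≡⟨ cong (λ x → a * (x * (2 * suc c) ^ T)) (^-distribˡ-+-* 2 (T + T) e) ⟩
    a * (2 ^ (T + T) * 2 ^ e * (2 * suc c) ^ T)      ≡⟨ regroup a (2 ^ (T + T)) (2 ^ e) ((2 * suc c) ^ T) ⟩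
    a * (2 ^ (T + T) * (2 * suc c) ^ T) * 2 ^ e      ≡⟨ cong (λ x → a * x * 2 ^ e) (2^[n+n]*[2c]^n≡[8c]^n (suc c) T) ⟩
    a * (8 * suc c) ^ T * 2 ^ e                      <⟨ *-monoˡ-< (2 ^ e) {{m^n≢0 2 e}} a*[8c]^T<[9c]^T ⟩
    (9 * suc c) ^ T * 2 ^ e                          ≤⟨ *-mono-≤ (^-monoˡ-≤ T (9[1+c]≤[3+2c]² c))
                                                                  (^-monoˡ-≤ e (s≤s (s≤s z≤n))) ⟩
    (s * s) ^ T * s ^ e                              ≡⟨ cong (_* s ^ e) (trans (^-distribʳ-* s s T) (sym (^-distribˡ-+-* s T T))) ⟩
    s ^ (T + T) * s ^ e                              ≡⟨ ^-distribˡ-+-* s (T + T) e ⟨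
    s ^ (T + T + e)                                  ∎
    where
    open ≤-Reasoning
    e = N ∸ (T + T)
    s = suc (2 * suc c)
    regroup : ∀ a x y z → a * (x * y * z) ≡ a * (x * z) * y
    regroup = solve-∀
    a*[8c]^T<[9c]^T : a * (8 * suc c) ^ T < (9 * suc c) ^ T
    a*[8c]^T<[9c]^T = begin-strict
      a * (8 * suc c) ^ T        ≡⟨ cong (a *_) (^-distribʳ-* 8 (suc c) T) ⟩
      a * (8 ^ T * suc c ^ T)    ≡⟨ *-assoc a (8 ^ T) (suc c ^ T) ⟨
      a * 8 ^ T * suc c ^ T      <⟨ *-monoˡ-< (suc c ^ T) {{m^n≢0 (suc c) T}} (8a≤n⇒a*8^n<9^n {a} 8a≤T) ⟩
      9 ^ T * suc c ^ T          ≡⟨ ^-distribʳ-* 9 (suc c) T ⟨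
      (9 * suc c) ^ T            ∎

  walks-ball*q<[2c+1]^N : ∀ c k q {N} → 2 ≤ k → 1 ≤ q → 8 * ((k + k) * q * ((k + k) * q)) ≤ N →
                          ∀ y → walks (suc c) N (ball k) y * q < suc (2 * suc c) ^ N
  walks-ball*q<[2c+1]^N c k q {N} 2≤k 1≤q 8M²≤N y = *-cancelˡ-< (2 * 2 ^ T) _ _ (begin-strict
    2 * 2 ^ T * (W * q)
      ≡⟨ regroup (2 ^ T) W q ⟩
    2 * q * (2 ^ T * W)
      ≤⟨ *-monoʳ-≤ (2 * q) (walks-ball≤ (s≤s z≤n) k T N y) ⟩
    2 * q * (2 ^ T * (2 ^ N * (2 * suc c) ^ T) + (k + k) * central T * s ^ N)
      ≡⟨ distribute q (k + k) (2 ^ T) (2 ^ N * (2 * suc c) ^ T) (central T) (s ^ N) ⟩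
    2 ^ T * (2 * q * (2 ^ N * (2 * suc c) ^ T)) + 2 * M * central T * s ^ N
      <⟨ +-mono-<-≤ (*-monoʳ-< (2 ^ T) {{m^n≢0 2 T}} (a*2^N*[2c]^T<[2c+1]^N c {2 * q} 16q≤T 2T≤N))
                    (*-monoˡ-≤ (s ^ N) (a*central[2t]≤2^[2t] t (2 * M) [2M]²≤T+1)) ⟩
    2 ^ T * s ^ N + 2 ^ T * s ^ N
      ≡⟨ twice (2 ^ T) (s ^ N) ⟨
    2 * 2 ^ T * s ^ N ∎)
    where
    open ≤-Reasoning
    M = (k + k) * q
    t = 2 * (M * M)
    T = t + t
    s = suc (2 * suc c)
    W = walks (suc c) N (ball k) y
    twice : ∀ x y → 2 * x * y ≡ x * y + x * y
    twice = solve-∀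
    regroup : ∀ x w q → 2 * x * (w * q) ≡ 2 * q * (x * w)
    regroup = solve-∀
    distribute : ∀ q L x y z w → 2 * q * (x * y + L * z * w) ≡ x * (2 * q * y) + 2 * (L * q) * z * w
    distribute = solve-∀
    T≡4M² : ∀ M → 2 * (M * M) + 2 * (M * M) ≡ 4 * (M * M)
    T≡4M² = solve-∀
    [2M]²≤T+1 : 2 * M * (2 * M) ≤ suc T
    [2M]²≤T+1 = ≤-trans (≤-reflexive (trans (square M) (sym (T≡4M² M)))) (n≤1+n T)
      where square : ∀ M → 2 * M * (2 * M) ≡ 4 * (M * M)
            square = solve-∀
    16q≤T : 8 * (2 * q) ≤ T
    16q≤T = begin
      8 * (2 * q)   ≡⟨ sixteen q ⟩
      4 * (4 * q)   ≤⟨ *-monoʳ-≤ 4 (*-mono-≤ 4≤M q≤M) ⟩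
      4 * (M * M)   ≡⟨ T≡4M² M ⟨
      T             ∎
      where
      sixteen : ∀ q → 8 * (2 * q) ≡ 4 * (4 * q)
      sixteen = solve-∀
      4≤M : 4 ≤ M
      4≤M = *-mono-≤ (+-mono-≤ 2≤k 2≤k) 1≤q
      q≤M : q ≤ M
      q≤M = ≤-trans (≤-reflexive (sym (*-identityˡ q))) (*-monoˡ-≤ q (≤-trans (s≤s z≤n) (+-mono-≤ 2≤k 2≤k)))
    2T≤N : T + T ≤ N
    2T≤N = ≤-trans (≤-reflexive (octuple M)) 8M²≤N
      where octuple : ∀ M → 2 * (M * M) + 2 * (M * M) + (2 * (M * M) + 2 * (M * M)) ≡ 8 * (M * M)
            octuple = solve-∀

  length-steps : ∀ n c → length (steps n c) ≡ suc (2 * c) ^ n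
  length-steps zero    c = refl
  length-steps (suc n) c = begin
    length (concatMap (λ z → map (z ∷_) (steps n c)) (range c))
      ≡⟨ length-concatMap (λ z → map (z ∷_) (steps n c)) (range c) ⟩
    sum (map (λ z → length (map (z ∷_) (steps n c))) (range c))
      ≡⟨ sum-map-cong (λ z → trans (length-map (z ∷_) (steps n c)) (length-steps n c)) (range c) ⟩
    sum (map (λ _ → suc (2 * c) ^ n) (range c))
      ≡⟨ sum-map-const (suc (2 * c) ^ n) (range c) ⟩
    length (range c) * suc (2 * c) ^ n
      ≡⟨ cong (_* suc (2 * c) ^ n) (trans (length-map (λ i → + i ℤ.- + c) (upTo (suc (2 * c)))) (length-upTo (suc (2 * c)))) ⟩
    suc (2 * c) ^ suc n ∎
    where open ≡-Reasoning

  goodWalks≤walks : ∀ n c k m x (xs : Vec ℤ n) →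
    goodWalks (suc n) c k m (x ∷ xs) ≤ (suc (2 * c) ^ n) ^ m * walks c m (ball k) x
  goodWalks≤walks n c k zero x xs with ∣ x ∣ ⊔ ‖ xs ‖ ℕ.<ᵇ k in ‖x∷xs‖<ᵇk | ∣ x ∣ ℕ.<ᵇ k in ∣x∣<ᵇk
  ... | false | _     = z≤n
  ... | true  | true  = ≤-refl
  ... | true  | false = ⊥-elim (subst Bool.T ∣x∣<ᵇk (<⇒<ᵇ (≤-<-trans (m≤m⊔n ∣ x ∣ ‖ xs ‖)
                                                                  (<ᵇ⇒< _ k (subst Bool.T (sym ‖x∷xs‖<ᵇk) tt)))))
  goodWalks≤walks n c k (suc m) x xs = begin
    sum (map (λ s → goodWalks (suc n) c k m (zipWith ℤ._+_ (x ∷ xs) s)) (concatMap (λ z → map (z ∷_) (steps n c)) (range c)))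
      ≡⟨ sum-map-concatMap _ (λ z → map (z ∷_) (steps n c)) (range c) ⟩
    sum (map (λ z → sum (map (λ s → goodWalks (suc n) c k m (zipWith ℤ._+_ (x ∷ xs) s)) (map (z ∷_) (steps n c)))) (range c))
      ≡⟨ sum-map-cong (λ z → cong sum (sym (map-∘ (steps n c)))) (range c) ⟩
    sum (map (λ z → sum (map (λ v → goodWalks (suc n) c k m ((x ℤ.+ z) ∷ zipWith ℤ._+_ xs v)) (steps n c))) (range c))
      ≤⟨ sum-map-mono (λ z → sum-map-mono (λ v → goodWalks≤walks n c k m (x ℤ.+ z) (zipWith ℤ._+_ xs v)) (steps n c)) (range c) ⟩
    sum (map (λ z → sum (map (λ _ → S ^ m * walks c m (ball k) (x ℤ.+ z)) (steps n c))) (range c))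
      ≡⟨ sum-map-cong (λ z → trans (sum-map-const _ (steps n c))
                                   (trans (cong (_* (S ^ m * walks c m (ball k) (x ℤ.+ z))) (length-steps n c))
                                          (sym (*-assoc S (S ^ m) _)))) (range c) ⟩
    sum (map (λ z → S ^ suc m * walks c m (ball k) (x ℤ.+ z)) (range c))
      ≡⟨ sum-map-*ˡ (S ^ suc m) (λ z → walks c m (ball k) (x ℤ.+ z)) (range c) ⟩
    S ^ suc m * walks c (suc m) (ball k) x ∎
    where open ≤-Reasoning
          S = suc (2 * c) ^ n

  4*[2k]^n≤sizeH : ∀ n k c → 4 * (suc k + suc k) ^ n ≤ sizeH (suc n) (suc k) (suc c)
  4*[2k]^n≤sizeH n k c = begin
    4 * (suc k + suc k) ^ n ≤⟨ *-mono-≤ 4≤a∸b (^-monoˡ-≤ n 2k≤a) ⟩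
    (a ∸ b) * a ^ n         ≤⟨ [a∸b]*a^n≤a^[1+n]∸b^[1+n] n (≤-trans (m≤m+n b _) (≤-reflexive (sym a≡b+d))) ⟩
    a ^ suc n ∸ b ^ suc n   ∎
    where
    open ≤-Reasoning
    a = suc (2 * (suc k + suc c))
    b = suc (2 * k)
    a≡b+d : a ≡ b + (2 + 2 * suc c)
    a≡b+d = split k c
      where split : ∀ k c → 1 + 2 * ((1 + k) + (1 + c)) ≡ (1 + 2 * k) + (2 + 2 * (1 + c))
            split = solve-∀
    4≤a∸b : 4 ≤ a ∸ b
    4≤a∸b = subst (4 ≤_) (sym (trans (cong (_∸ b) a≡b+d) (m+n∸m≡n b _))) (+-monoʳ-≤ 2 (*-monoʳ-≤ 2 (s≤s z≤n)))
    2k≤a : suc k + suc k ≤ a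
    2k≤a = ≤-trans (m≤m+n (suc k + suc k) (suc (2 * suc c))) (≤-reflexive (split k c))
      where split : ∀ k c → (1 + k) + (1 + k) + (1 + 2 * (1 + c)) ≡ 1 + 2 * ((1 + k) + (1 + c))
            split = solve-∀

  8[2kq]²≤4[2k]³ : ∀ k q → q * q ≤ k → 8 * ((k + k) * q * ((k + k) * q)) ≤ 4 * (k + k) ^ 3
  8[2kq]²≤4[2k]³ k q q²≤k = begin
    8 * ((k + k) * q * ((k + k) * q))  ≡⟨ lhs k q ⟩
    8 * ((k + k) * (k + k)) * (q * q)  ≤⟨ *-monoʳ-≤ (8 * ((k + k) * (k + k))) q²≤k ⟩
    8 * ((k + k) * (k + k)) * k        ≡⟨ rhs k ⟨
    4 * (k + k) ^ 3                    ∎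
    where
    open ≤-Reasoning
    lhs : ∀ k q → 8 * ((k + k) * q * ((k + k) * q)) ≡ 8 * ((k + k) * (k + k)) * (q * q)
    lhs = solve-∀
    rhs : ∀ k → 4 * ((k + k) * ((k + k) * ((k + k) * 1))) ≡ 8 * ((k + k) * (k + k)) * k
    rhs = solve-∀

  goodWalks*q<totalWalks : ∀ n c k q → 3 ≤ n → 2 ≤ k → 1 ≤ q → q * q ≤ k →
    let N = sizeH (suc n) k (suc c)
    in goodWalks (suc n) (suc c) k N (origin (suc n)) * q < totalWalks (suc n) (suc c) N
  goodWalks*q<totalWalks n c k@(suc (suc k′)) q 3≤n 2≤k@(s≤s (s≤s _)) 1≤q q²≤k = begin-strict
    goodWalks (suc n) (suc c) k N (origin (suc n)) * q  ≤⟨ *-monoˡ-≤ q (goodWalks≤walks n (suc c) k N (+ 0) (origin n)) ⟩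
    (s ^ n) ^ N * W * q                                 ≡⟨ *-assoc ((s ^ n) ^ N) W q ⟩
    (s ^ n) ^ N * (W * q)                               <⟨ *-monoʳ-< ((s ^ n) ^ N) {{m^n≢0 (s ^ n) N {{m^n≢0 s n}}}}
                                                           (walks-ball*q<[2c+1]^N c k q 2≤k 1≤q 8[2kq]²≤N (+ 0)) ⟩
    (s ^ n) ^ N * s ^ N                                 ≡⟨ *-comm ((s ^ n) ^ N) (s ^ N) ⟩
    s ^ N * (s ^ n) ^ N                                 ≡⟨ ^-distribʳ-* s (s ^ n) N ⟨
    (s * s ^ n) ^ N                                     ∎
    where
    open ≤-Reasoning
    N = sizeH (suc n) k (suc c)
    s = suc (2 * suc c)
    W = walks (suc c) N (ball k) (+ 0)
    8[2kq]²≤N : 8 * ((k + k) * q * ((k + k) * q)) ≤ N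
    8[2kq]²≤N = ≤-trans (8[2kq]²≤4[2k]³ k q q²≤k)
                        (≤-trans (*-monoʳ-≤ 4 (^-monoʳ-≤ (k + k) 3≤n)) (4*[2k]^n≤sizeH n (suc k′) c))

  fraction<positive : ∀ ε → 0ℚ <ℚ ε →
    ∃₂ λ p q → ∀ a b .{{_ : NonZero b}} → a * suc q < suc p * b → (+ a) / b <ℚ ε
  fraction<positive (mkℚ (+ zero)   _ _) (ℚ.*<* (ℤ.+<+ ()))
  fraction<positive (mkℚ -[1+ _ ]   _ _) (ℚ.*<* ())
  fraction<positive ε@(mkℚ (+ suc p) q _) _ = p , q , λ where
    a (suc b) aq<pb → ℚ.toℚᵘ-cancel-<
      (ℚᵘ.<-respˡ-≃ (ℚᵘ.≃-sym (ℚ.toℚᵘ-fromℚᵘ (ℚᵘ.mkℚᵘ (+ a) b)))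
        (ℚᵘ.*<* (subst₂ ℤ._<_ (ℤ.pos-* a (suc q)) (ℤ.pos-* (suc p) (suc b)) (ℤ.+<+ aq<pb))))

open RandomWalk

open import Data.Nat using (ℕ; suc; _*_; _^_; _≤_; z≤n; s≤s)
open import Data.Nat.Properties using (≤-trans; <-≤-trans; n≤1+n; m≤m+n; m^n≢0)
open import Data.Product using (∃-syntax; _,_)
open import Data.Rational using (ℚ; 0ℚ; _<_)

theorem4 : (n c : ℕ) → 4 ≤ n → 1 ≤ c →
    (ε : ℚ) → 0ℚ < ε →
    ∃[ K ] ((k : ℕ) → K ≤ k → probA n k c < ε)
theorem4 (suc n) (suc c) (s≤s 3≤n) _ ε 0<ε with fraction<positive ε 0<ε
... | p , q , frac<ε = K , probA<ε
  where
  K = suc (suc q * suc q)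
  probA<ε : (k : ℕ) → K ≤ k → probA (suc n) k (suc c) < ε
  probA<ε k K≤k = frac<ε (goodWalks (suc n) (suc c) k N (origin (suc n))) (totalWalks (suc n) (suc c) N)
                         {{m^n≢0 (s ^ suc n) N {{m^n≢0 s (suc n)}}}}
                         (<-≤-trans (goodWalks*q<totalWalks n c k (suc q) 3≤n 2≤k (s≤s z≤n) q²≤k) (m≤m+n _ _))
    where
    N = sizeH (suc n) k (suc c)
    s = suc (2 * suc c)
    2≤k : 2 ≤ k
    2≤k = ≤-trans (s≤s (s≤s z≤n)) K≤k
    q²≤k : suc q * suc q ≤ k
    q²≤k = ≤-trans (n≤1+n _) K≤k
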